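{- Let $T$ be a Steiner-closed search tree on a tree $S$, and let $q\in V(T)$ have parent $p$. Let $T'$ be the tree obtained by rotating the edge $\{q,p\}$. Then $T'$ is Steiner-closed if and only if $|\delta(T_p)|\ne 2$ or $|\delta(T_q)|\ne 1$.
   Context: A search tree on an unrooted tree $S$ (STT) is a rooted tree $T$ with $V(T)=V(S)$ defined recursively: the root $r$ is any node of $S$, and the subtrees of $T$ rooted at the children of $r$ are search trees on the connected components of $S\setminus r$. $T_y$ is the subtree of $T$ rooted at $y$; $\delta(T_y)$ is the set of nodes outside $V(T_y)$ adjacent in $S$ to a node of $V(T_y)$. The convex hull $\mathrm{ch}(A)$ of $A\subseteq V(S)$ is the subtree of $S$ induced by the union of all paths between nodes of $A$; $A$ is Steiner-closed if every node of $\mathrm{ch}(A)\setminus A$ is adjacent to exactly two nodes of $\mathrm{ch}(A)$; $T$ is Steiner-closed if the node set of every root-to-node path is Steiner-closed. Rotating the edge $\{q,p\}$ ($q$ child of $p$): $q$ and $p$ swap places; if $q$ has a child $y$ whose subtree contains a node adjacent to $p$ in $S$, then $y$ becomes a child of $p$; all other children keep their parents. -}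

module Defs where

open import Level using (0ℓ)
open import Data.Nat using (ℕ; _≤_)
open import Data.Fin using (Fin)
open import Data.List using (List; []; _∷_; length)
open import Data.List.Membership.Propositional using (_∈_)
open import Data.List.Relation.Unary.All using (All)
open import Data.List.Relation.Unary.Unique.Propositional using (Unique)
open import Data.Maybe using (Maybe; just; nothing)
open import Data.Product using (Σ; ∃; ∃-syntax; _×_; _,_)
open import Data.Sum using (_⊎_)
open import Relation.Nullary using (¬_)
open import Relation.Binary using (Rel; Decidable)
open import Relation.Binary.PropositionalEquality using (_≡_; _≢_)
open import Function.Bundles using (_⇔_)

VSet : ℕ → Set₁
VSet n = Fin n → Set

HasSize : ∀ {n} → VSet n → ℕ → Set
HasSize {n} P k = Σ (List (Fin n)) λ vs → Unique vs × length vs ≡ k × (∀ x → P x ⇔ (x ∈ vs))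

data PathFrom {n} (adj : Rel (Fin n) 0ℓ) : Fin n → Fin n → List (Fin n) → Set where
  here : ∀ {x} → PathFrom adj x x (x ∷ [])
  step : ∀ {x z y vs} → adj x z → PathFrom adj z y vs → PathFrom adj x y (x ∷ vs)

SimplePath : ∀ {n} → Rel (Fin n) 0ℓ → Fin n → Fin n → List (Fin n) → Set
SimplePath adj x y vs = PathFrom adj x y vs × Unique vs

record UTree (n : ℕ) : Set₁ where
  field
    adj       : Rel (Fin n) 0ℓ
    adj?      : Decidable adj
    sym       : ∀ {x y} → adj x y → adj y x
    irrefl    : ∀ {x} → ¬ adj x x
    connected : ∀ x y → ∃[ vs ] PathFrom adj x y vs
    acyclic   : ∀ x y vs → SimplePath adj x y vs → 3 ≤ length vs → ¬ adj y x

module _ {n : ℕ} (S : UTree n) where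
  open UTree S

  ConnectedIn : VSet n → Set
  ConnectedIn U = ∀ x y → U x → U y → ∃[ vs ] (PathFrom adj x y vs × All U vs)

  ch : VSet n → VSet n
  ch A x = ∃[ a ] ∃[ b ] ∃[ vs ] (A a × A b × SimplePath adj a b vs × x ∈ vs)

  SteinerClosedSet : VSet n → Set
  SteinerClosedSet A = ∀ x → ch A x → ¬ A x →
    HasSize (λ w → adj x w × ch A w) 2

Parent : ℕ → Set
Parent n = Fin n → Maybe (Fin n)

-- Anc par x y : y is an ancestor of x (or x itself).
data Anc {n} (par : Parent n) : Fin n → Fin n → Set where
  self : ∀ {x} → Anc par x x
  up   : ∀ {x z y} → par x ≡ just z → Anc par z y → Anc par x y

IsRootedTree : ∀ {n} → Parent n → Set
IsRootedTree {n} par = ∃[ r ] (par r ≡ nothing × (∀ x → Anc par x r))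

Sub : ∀ {n} → Parent n → Fin n → VSet n
Sub par y x = Anc par x y

module _ {n : ℕ} (S : UTree n) where
  open UTree S

  δ : Parent n → Fin n → VSet n
  δ par y x = ¬ Sub par y x × ∃[ u ] (Sub par y u × adj u x)

  -- Search tree on S (the recursive definition unfolded): every node's
  -- subtree is a search tree on the part of S it spans, i.e. for every
  -- child c of y, V(T_c) is a connected component of S[V(T_y)] minus y.
  IsSTT : Parent n → Set
  IsSTT par = IsRootedTree par ×
    (∀ y c → par c ≡ just y →
       ConnectedIn S (Sub par c) ×
       (∀ u w → Sub par c u → Sub par y w → w ≢ y → ¬ Sub par c w → ¬ adj u w))

  SteinerClosed : Parent n → Set
  SteinerClosed par = ∀ y → SteinerClosedSet S (λ z → Anc par y z)

  IsRotation : Parent n → Fin n → Fin n → Parent n → Set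
  IsRotation par q p par' =
    par' q ≡ par p ×
    par' p ≡ just q ×
    (∀ x → x ≢ q → x ≢ p →
       let moves = par x ≡ just q × ∃[ u ] (Sub par x u × adj u p) in
       (moves → par' x ≡ just p) × (¬ moves → par' x ≡ par x))

module Submission where

-- Write P(y) for the root path of y in T; T is Steiner-closed iff every P(y) is, and a set A is
-- Steiner-closed iff no node of ch(A) outside A has three neighbours in ch(A) (no "fork").
-- The rotation changes root paths in two ways only: nodes of T_p ∖ T_q gain q, and the nodes of
-- T_q that do not move below p lose p.  Adding q is harmless because T_q meets the rest of S only
-- through δ(T_q) ⊆ P(q).  Removing p can only create a fork at p itself.  Every hull neighbour of
-- p reaches, avoiding p, either T_q or a point of δ(T_p), and distinct neighbours of p lie in
-- distinct components of S − p.  Since T_p is connected and disjoint from the Steiner-closed set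
-- P(parent p) ⊇ δ(T_p), |δ(T_p)| ≤ 2; so a fork at p forces δ(T_p) = {e, e'} with one neighbour
-- reaching T_q, and if |δ(T_q)| ≠ 1 some boundary point of T_q other than p lies in δ(T_p) and
-- joins T_q to e or e' avoiding p, which is impossible.  Conversely, if δ(T_p) = {d₁, d₂} and
-- δ(T_q) = {p}, the path from q through p to d₁ and a path from d₂ to p inside T_p ∖ T_q meet at a
-- node outside P(q) ∖ {p}, the new root path of q, which has three neighbours in its hull.

open import Defs
open import Level using (0ℓ)
open import Data.Nat using (ℕ; s≤s; z≤n)
open import Data.Fin using (Fin)
open import Data.Fin.Properties using (_≟_; any?)
open import Data.List using (List; []; _∷_; _++_; [_])
open import Data.List.Membership.Propositional using (_∈_; _∉_)
open import Data.List.Membership.Propositional.Properties using (∈-++⁺ˡ; ∈-++⁺ʳ; ∈-++⁻)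
open import Data.List.Relation.Binary.Subset.Propositional using (_⊆_)
open import Data.List.Relation.Unary.Any using (here; there; toSum)
open import Data.List.Relation.Unary.All using (All; []; _∷_)
import Data.List.Relation.Unary.All as All
open import Data.List.Relation.Unary.All.Properties using (¬Any⇒All¬) renaming (++⁺ to All-++⁺)
open import Data.List.Relation.Unary.AllPairs using ([]; _∷_)
open import Data.List.Relation.Unary.Unique.Propositional using (Unique)
open import Data.List.Relation.Unary.Unique.Propositional.Properties using (Unique[x∷xs]⇒x∉xs)
import Data.List.Relation.Unary.Unique.Propositional.Properties as Unique
open import Data.Maybe using (just; nothing)
open import Data.Maybe.Properties using (just-injective; ≡-dec)
open import Data.Product using (∃; ∃-syntax; _×_; _,_; proj₁; proj₂)
open import Data.Sum using (_⊎_; inj₁; inj₂; [_,_]′)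
open import Data.Empty using (⊥; ⊥-elim)
open import Relation.Nullary using (¬_; Dec; yes; no)
open import Relation.Nullary.Decidable using (_×-dec_; ¬?)
open import Relation.Unary using (∁; Decidable)
open import Relation.Binary using (Rel; Symmetric)
open import Relation.Binary.PropositionalEquality using (_≡_; _≢_; refl; sym; trans; subst)
open import Function.Bundles using (_⇔_; mk⇔; Equivalence)
open import Function using (id; _∘_)

module _ {a} {A : Set a} where

  ∈[x]⇒≡ : ∀ {x z : A} → z ∈ [ x ] → z ≡ x
  ∈[x]⇒≡ (here z≡x) = z≡x

  Unique-∷ : ∀ {x : A} {xs} → x ∉ xs → Unique xs → Unique (x ∷ xs)
  Unique-∷ x∉xs xs! = ¬Any⇒All¬ _ x∉xs ∷ xs!

  Unique-tail : ∀ {x : A} {xs} → Unique (x ∷ xs) → Unique xs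
  Unique-tail (_ ∷ xs!) = xs!

  Unique-[x] : ∀ {x : A} → Unique [ x ]
  Unique-[x] = [] ∷ []

  Unique-++⁻ʳ : ∀ xs {ys : List A} → Unique (xs ++ ys) → Unique ys
  Unique-++⁻ʳ []       xs++ys! = xs++ys!
  Unique-++⁻ʳ (_ ∷ xs) (_ ∷ xs++ys!) = Unique-++⁻ʳ xs xs++ys!

  Unique-meet : ∀ xs {ys} {w z : A} → Unique (xs ++ w ∷ ys) → z ∈ xs ++ [ w ] → z ∈ w ∷ ys → z ≡ w
  Unique-meet xs       _   z∈xs+w   (here z≡w) = z≡w
  Unique-meet []       _   (here z≡w) (there _) = z≡w
  Unique-meet (x ∷ xs) (x∉ ∷ _) (here refl) (there z∈ys) = ⊥-elim (All.lookup x∉ (∈-++⁺ʳ xs (there z∈ys)) refl)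
  Unique-meet (x ∷ xs) (_ ∷ u) (there z∈) z∈wys = Unique-meet xs u z∈ z∈wys

  ++-[x]-⊆ : ∀ xs {ys} {x : A} → xs ++ [ x ] ⊆ xs ++ x ∷ ys
  ++-[x]-⊆ xs = [ ∈-++⁺ˡ , ∈-++⁺ʳ xs ∘ here ∘ ∈[x]⇒≡ ]′ ∘ ∈-++⁻ xs

  ∷-⊆ : ∀ {x : A} {xs ys} → xs ⊆ ys → x ∷ xs ⊆ x ∷ ys
  ∷-⊆ xs⊆ys (here z≡x) = here z≡x
  ∷-⊆ xs⊆ys (there z∈xs) = there (xs⊆ys z∈xs)

module Paths {n : ℕ} (adj : Rel (Fin n) 0ℓ) where

  private
    V = Fin n
    Path = PathFrom adj

  open import Data.List.Membership.DecPropositional (_≟_ {n}) using (_∈?_)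

  head∈ : ∀ {x y vs} → Path x y vs → x ∈ vs
  head∈ here       = here refl
  head∈ (step _ _) = here refl

  last∈ : ∀ {x y vs} → Path x y vs → y ∈ vs
  last∈ here       = here refl
  last∈ (step _ π) = there (last∈ π)

  nodes-start : ∀ {x y vs} → Path x y vs → ∃[ t ] vs ≡ x ∷ t
  nodes-start here       = _ , refl
  nodes-start (step _ _) = _ , refl

  second-node : ∀ {x y ts} → Path x y (x ∷ ts) → x ≢ y → ∃[ z ] (adj x z × z ∈ ts)
  second-node here        x≢y = ⊥-elim (x≢y refl)
  second-node (step xz π) _   = _ , xz , head∈ π

  _▷_ : ∀ {x y z vs} → Path x y vs → adj y z → Path x z (vs ++ [ z ])
  here       ▷ yz = step yz here
  step xw π ▷ yz = step xw (π ▷ yz)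

  _⁀_ : ∀ {x m y vs ws} → Path x m vs → Path m y (m ∷ ws) → Path x y (vs ++ ws)
  here       ⁀ ρ = ρ
  step xw π ⁀ ρ = step xw (π ⁀ ρ)

  split : ∀ {a b vs w} → Path a b vs → w ∈ vs →
          ∃[ ws₁ ] ∃[ ws₂ ] (vs ≡ ws₁ ++ w ∷ ws₂ × Path a w (ws₁ ++ [ w ]) × Path w b (w ∷ ws₂))
  split here          (here refl) = [] , [] , refl , here , here
  split (step ab π)   (here refl) = [] , _ , refl , here , step ab π
  split (step ab π)   (there w∈)  with split π w∈
  ... | ws₁ , ws₂ , refl , pre , suf = _ ∷ ws₁ , ws₂ , refl , step ab pre , suf

  simplify : ∀ {x y vs} → Path x y vs → ∃[ ws ] (SimplePath adj x y ws × ws ⊆ vs)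
  simplify here = _ , (here , Unique-[x]) , id
  simplify {x} (step xz π) with simplify π
  ... | ws , (ρ , ws!) , ws⊆ with x ∈? ws
  ...   | no x∉ws = x ∷ ws , (step xz ρ , Unique-∷ x∉ws ws!) , ∷-⊆ ws⊆
  ...   | yes x∈ws with split ρ x∈ws
  ...     | ws₁ , ws₂ , refl , _ , suf = x ∷ ws₂ , (suf , Unique-++⁻ʳ ws₁ ws!) , there ∘ ws⊆ ∘ ∈-++⁺ʳ ws₁

  join-simple : ∀ {x m y vs ws} → SimplePath adj x m vs → SimplePath adj m y ws →
                (∀ {z} → z ∈ vs → z ∈ ws → z ≡ m) →
                ∃[ us ] (SimplePath adj x y us × vs ⊆ us × ws ⊆ us × us ⊆ vs ++ ws)
  join-simple {vs = vs} (π , vs!) (ρ , ws!) meet with nodes-start ρ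
  ... | t , refl = vs ++ t , (π ⁀ ρ , Unique.++⁺ vs! (Unique-tail ws!) disjoint) ,
                   ∈-++⁺ˡ , [ (λ { refl → ∈-++⁺ˡ (last∈ π) }) , ∈-++⁺ʳ vs ]′ ∘ toSum ,
                   [ ∈-++⁺ˡ , ∈-++⁺ʳ vs ∘ there ]′ ∘ ∈-++⁻ vs
    where
    disjoint : ∀ {z} → ¬ (z ∈ vs × z ∈ t)
    disjoint (z∈vs , z∈t) with meet z∈vs (there z∈t)
    ... | refl = Unique[x∷xs]⇒x∉xs ws! z∈t

  Boundary : VSet n → VSet n
  Boundary D x = ¬ D x × ∃[ u ] (D u × adj u x)

  module _ {D : VSet n} (D? : Decidable D) where

    first-in : ∀ {x y vs} → D y → Path x y vs →
               ∃[ z ] (D z × ∃[ ws ] (Path x z ws × ws ⊆ vs × (∀ {w} → w ∈ ws → D w → w ≡ z)))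
    first-in {x} Dy here = x , Dy , _ , here , id , λ { (here refl) _ → refl }
    first-in {x} Dy (step xz π) with D? x
    ... | yes Dx = x , Dx , _ , here , (λ { (here refl) → here refl }) , λ { (here refl) _ → refl }
    ... | no ¬Dx with first-in Dy π
    ...   | z , Dz , ws , ρ , ws⊆ , only-z = z , Dz , x ∷ ws , step xz ρ , ∷-⊆ ws⊆ ,
            λ { (here refl) Dx → ⊥-elim (¬Dx Dx) ; (there w∈) Dw → only-z w∈ Dw }

    first-exit : ∀ {x y vs} → D x → ¬ D y → Path x y vs →
                 ∃[ e ] (Boundary D e × ∃[ ws ] (Path x e ws × ws ⊆ vs))
    first-exit Dx ¬Dy here = ⊥-elim (¬Dy Dx)
    first-exit {x} Dx ¬Dy (step {z = z} xz π) with D? z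
    ... | no ¬Dz = z , (¬Dz , x , Dx , xz) , _ , step xz here ,
                   λ { (here refl) → here refl ; (there (here refl)) → there (head∈ π) }
    ... | yes Dz with first-exit Dz ¬Dy π
    ...   | e , ∂e , ws , ρ , ws⊆ = e , ∂e , x ∷ ws , step xz ρ , ∷-⊆ ws⊆

    stays-in : ∀ {x y vs} → D x → Path x y vs → All (∁ (Boundary D)) vs → D y
    stays-in Dx here _ = Dx
    stays-in Dx (step {z = z} xz π) (_ ∷ ok) with D? z
    ... | yes Dz = stays-in Dz π ok
    ... | no ¬Dz = ⊥-elim (All.lookup ok (head∈ π) (¬Dz , _ , Dx , xz))

  module _ (adj-sym : Symmetric adj) where

    reverse : ∀ {x y vs} → Path x y vs →
              ∃[ ws ] (Path y x ws × ws ⊆ vs × vs ⊆ ws × (Unique vs → Unique ws))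
    reverse here = _ , here , id , id , id
    reverse {x} (step xz π) with reverse π
    ... | ws , ρ , ws⊆ , ⊆ws , uniq = ws ++ [ x ] , ρ ▷ adj-sym xz ,
          [ there ∘ ws⊆ , here ∘ ∈[x]⇒≡ ]′ ∘ ∈-++⁻ ws ,
          (λ { (here refl) → ∈-++⁺ʳ ws (here refl) ; (there z∈) → ∈-++⁺ˡ (⊆ws z∈) }) ,
          λ { vs! → Unique.++⁺ (uniq (Unique-tail vs!)) Unique-[x]
                      λ { (z∈ws , here refl) → Unique[x∷xs]⇒x∉xs vs! (ws⊆ z∈ws) } }

    reverse-simple : ∀ {x y vs} → SimplePath adj x y vs → ∃[ ws ] (SimplePath adj y x ws × ws ⊆ vs × vs ⊆ ws)
    reverse-simple (π , vs!) with reverse π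
    ... | ws , ρ , ws⊆ , ⊆ws , uniq = ws , (ρ , uniq vs!) , ws⊆ , ⊆ws

    module _ {D : VSet n} (D? : Decidable D) where

      stays-out : ∀ {x y vs} → ¬ D x → Path x y vs → All (∁ (Boundary D)) vs → ¬ D y
      stays-out ¬Dx here _ = ¬Dx
      stays-out ¬Dx (step {z = z} xz π) (x-ok ∷ ok) with D? z
      ... | yes Dz = ⊥-elim (x-ok (¬Dx , _ , Dz , adj-sym xz))
      ... | no ¬Dz = stays-out ¬Dz π ok

      stays-out-until-boundary : ∀ {x y vs} → ¬ D x → SimplePath adj x y vs →
                                 (∀ {b} → Boundary D b → b ≡ y) → All (∁ D) vs
      stays-out-until-boundary ¬Dx (here , _) only-y = ¬Dx ∷ []
      stays-out-until-boundary ¬Dx (step {z = z} xz π , vs!) only-y with D? z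
      ... | yes Dz with only-y (¬Dx , _ , Dz , adj-sym xz)
      ...   | refl = ⊥-elim (Unique[x∷xs]⇒x∉xs vs! (last∈ π))
      stays-out-until-boundary ¬Dx (step {z = z} xz π , vs!) only-y | no ¬Dz =
        ¬Dx ∷ stays-out-until-boundary ¬Dz (π , Unique-tail vs!) only-y

    path-neighbours : ∀ {a b vs x} → SimplePath adj a b vs → x ∈ vs → x ≢ a → x ≢ b →
                      ∃[ w₁ ] ∃[ w₂ ] (w₁ ≢ w₂ × adj x w₁ × adj x w₂ × w₁ ∈ vs × w₂ ∈ vs)
    path-neighbours (here , _)     (here refl) x≢a _ = ⊥-elim (x≢a refl)
    path-neighbours (step _ _ , _) (here refl) x≢a _ = ⊥-elim (x≢a refl)
    path-neighbours {x = x} (step {z = z} az π , vs!) (there x∈) x≢a x≢b with x ≟ z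
    ... | yes refl = after-first az π vs! x≢b
      where
      after-first : ∀ {a b vs} → adj a x → Path x b vs → Unique (a ∷ vs) → x ≢ b →
                    ∃[ w₁ ] ∃[ w₂ ] (w₁ ≢ w₂ × adj x w₁ × adj x w₂ × w₁ ∈ a ∷ vs × w₂ ∈ a ∷ vs)
      after-first ax here          _   x≢b = ⊥-elim (x≢b refl)
      after-first ax (step xz' ρ) av! _   =
        _ , _ , (λ { refl → Unique[x∷xs]⇒x∉xs av! (there (head∈ ρ)) }) , adj-sym ax , xz' ,
        here refl , there (there (head∈ ρ))
    ... | no x≢z with path-neighbours (π , Unique-tail vs!) x∈ x≢z x≢b
    ...   | w₁ , w₂ , w₁≢w₂ , xw₁ , xw₂ , w₁∈ , w₂∈ =
      w₁ , w₂ , w₁≢w₂ , xw₁ , xw₂ , there w₁∈ , there w₂∈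

module _ {n : ℕ} {P : VSet n} where

  HasSize-2⇒pair : HasSize P 2 → ∃[ a ] ∃[ b ] (P a × P b × a ≢ b)
  HasSize-2⇒pair (a ∷ b ∷ [] , ab! , refl , iff) =
    a , b , Equivalence.from (iff a) (here refl) , Equivalence.from (iff b) (there (here refl)) ,
    Unique[x∷xs]⇒x∉xs ab! ∘ here

  HasSize-2⇒¬three : ∀ {a b c} → HasSize P 2 → P a → P b → P c → a ≢ b → a ≢ c → b ≢ c → ⊥
  HasSize-2⇒¬three (u ∷ v ∷ [] , _ , refl , iff) Pa Pb Pc a≢b a≢c b≢c
    with Equivalence.to (iff _) Pa | Equivalence.to (iff _) Pb | Equivalence.to (iff _) Pc
  ... | here refl         | here refl         | _                 = a≢b refl
  ... | there (here refl) | there (here refl) | _                 = a≢b refl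
  ... | here refl         | there (here refl) | here refl         = a≢c refl
  ... | here refl         | there (here refl) | there (here refl) = b≢c refl
  ... | there (here refl) | here refl         | here refl         = b≢c refl
  ... | there (here refl) | here refl         | there (here refl) = a≢c refl

  noThird⇒HasSize-2 : ∀ {a b} → P a → P b → a ≢ b → (∀ {c} → P c → c ≢ a → c ≢ b → ⊥) → HasSize P 2
  noThird⇒HasSize-2 {a} {b} Pa Pb a≢b no-third =
    a ∷ b ∷ [] , Unique-∷ (λ { (here a≡b) → a≢b a≡b }) Unique-[x] , refl ,
    λ c → mk⇔ (member c) λ { (here refl) → Pa ; (there (here refl)) → Pb }
    where
    member : ∀ c → P c → c ∈ a ∷ b ∷ []
    member c Pc with c ≟ a | c ≟ b
    ... | yes c≡a | _       = here c≡a
    ... | no _    | yes c≡b = there (here c≡b)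
    ... | no c≢a  | no c≢b  = ⊥-elim (no-third Pc c≢a c≢b)

  HasSize-1⇒≡ : ∀ {a c} → HasSize P 1 → P a → P c → c ≡ a
  HasSize-1⇒≡ (u ∷ [] , _ , refl , iff) Pa Pc with Equivalence.to (iff _) Pa | Equivalence.to (iff _) Pc
  ... | here refl | here refl = refl

  HasSize-1⊎another : ∀ {a} → Decidable P → P a → HasSize P 1 ⊎ ∃[ b ] (P b × b ≢ a)
  HasSize-1⊎another {a} P? Pa with any? (λ b → P? b ×-dec ¬? (b ≟ a))
  ... | yes (b , Pb , b≢a) = inj₂ (b , Pb , b≢a)
  ... | no no-other = inj₁ (a ∷ [] , Unique-[x] , refl , λ c → mk⇔ (here ∘ only-a c) λ { (here refl) → Pa })
    where
    only-a : ∀ c → P c → c ≡ a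
    only-a c Pc with c ≟ a
    ... | yes c≡a = c≡a
    ... | no c≢a  = ⊥-elim (no-other (c , Pc , c≢a))

module Hull {n : ℕ} (S : UTree n) where

  open UTree S renaming (sym to adj-sym)
  open Paths adj public
  open import Data.List.Membership.DecPropositional (_≟_ {n}) using (_∈?_)
  open import Relation.Nullary.Decidable using (_⊎-dec_)

  private
    V = Fin n
    Path = PathFrom adj

  adj⇒≢ : ∀ {x y} → adj x y → y ≢ x
  adj⇒≢ xy refl = irrefl xy

  Linked : V → V → V → Set
  Linked v u w = ∃[ vs ] (Path u w vs × v ∉ vs)

  Linked-refl : ∀ {v u} → u ≢ v → Linked v u u
  Linked-refl u≢v = _ , here , λ { (here refl) → u≢v refl }

  Linked-sym : ∀ {v u w} → Linked v u w → Linked v w u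
  Linked-sym (vs , π , v∉) with reverse adj-sym π
  ... | ws , ρ , ws⊆ , _ = ws , ρ , v∉ ∘ ws⊆

  Linked-trans : ∀ {v u w x} → Linked v u w → Linked v w x → Linked v u x
  Linked-trans (vs , π , v∉vs) (ws , ρ , v∉ws) with nodes-start ρ
  ... | t , refl = vs ++ t , π ⁀ ρ , [ v∉vs , v∉ws ∘ there ]′ ∘ ∈-++⁻ vs

  Linked-adj : ∀ {v u w} → adj u w → u ≢ v → w ≢ v → Linked v u w
  Linked-adj uw u≢v w≢v = _ , step uw here , λ { (here refl) → u≢v refl ; (there (here refl)) → w≢v refl }

  neighbours-unlinked : ∀ {v w w'} → w ≢ w' → adj v w → adj v w' → ¬ Linked v w w'
  neighbours-unlinked {v} w≢w' vw vw' (vs , π , v∉vs) with simplify π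
  ... | ws , (ρ , ws!) , ws⊆ = cycle w≢w' vw vw' ρ ws! (v∉vs ∘ ws⊆)
    where
    cycle : ∀ {a b ws} → a ≢ b → adj v a → adj v b → Path a b ws → Unique ws → v ∉ ws → ⊥
    cycle a≢b _  _  here          _   _   = a≢b refl
    cycle _   va vb (step az σ) ws! v∉ with nodes-start σ
    ... | _ , refl = acyclic v _ _ (step va (step az σ) , Unique-∷ v∉ ws!) (s≤s (s≤s (s≤s z≤n))) (adj-sym vb)

  neighbours-unlinked-via : ∀ {v w w' z z'} → w ≢ w' → adj v w → adj v w' →
                            Linked v w z → Linked v w' z' → ¬ Linked v z z'
  neighbours-unlinked-via w≢w' vw vw' w~z w'~z' z~z' =
    neighbours-unlinked w≢w' vw vw' (Linked-trans w~z (Linked-trans z~z' (Linked-sym w'~z')))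

  ch-path : ∀ {A : VSet n} {a b vs z} → A a → A b → SimplePath adj a b vs → z ∈ vs → ch S A z
  ch-path Aa Ab σ z∈ = _ , _ , _ , Aa , Ab , σ , z∈

  ch-⊇ : ∀ {A : VSet n} {z} → A z → ch S A z
  ch-⊇ Az = ch-path Az Az (here , Unique-[x]) (here refl)

  ch-mono : ∀ {A B : VSet n} → (∀ {z} → A z → B z) → ∀ {x} → ch S A x → ch S B x
  ch-mono A⊆B (a , b , vs , Aa , Ab , σ , x∈) = a , b , vs , A⊆B Aa , A⊆B Ab , σ , x∈

  HullNeighbour : VSet n → V → V → Set
  HullNeighbour A x w = adj x w × ch S A w

  record Fork (A : VSet n) (x : V) : Set where
    field
      {w₁ w₂ w₃} : V
      w₁≢w₂ : w₁ ≢ w₂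
      w₁≢w₃ : w₁ ≢ w₃
      w₂≢w₃ : w₂ ≢ w₃
      neighbour₁ : HullNeighbour A x w₁
      neighbour₂ : HullNeighbour A x w₂
      neighbour₃ : HullNeighbour A x w₃

  ForkFree : VSet n → Set
  ForkFree A = ∀ x → ch S A x → ¬ A x → ¬ Fork A x

  steinerClosed⇒forkFree : ∀ {A} → SteinerClosedSet S A → ForkFree A
  steinerClosed⇒forkFree sc x x∈ch x∉A fork =
    HasSize-2⇒¬three (sc x x∈ch x∉A) neighbour₁ neighbour₂ neighbour₃ w₁≢w₂ w₁≢w₃ w₂≢w₃
    where open Fork fork

  forkFree⇒steinerClosed : ∀ {A} → ForkFree A → SteinerClosedSet S A
  forkFree⇒steinerClosed {A} ff x x∈ch@(a , b , vs , Aa , Ab , σ , x∈) x∉A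
    with path-neighbours adj-sym σ x∈ (λ { refl → x∉A Aa }) (λ { refl → x∉A Ab })
  ... | w₁ , w₂ , w₁≢w₂ , xw₁ , xw₂ , w₁∈ , w₂∈ =
    noThird⇒HasSize-2 (xw₁ , ch-path Aa Ab σ w₁∈) (xw₂ , ch-path Aa Ab σ w₂∈) w₁≢w₂
      λ nb w≢w₁ w≢w₂ → ff x x∈ch x∉A (record
        { w₁≢w₂ = w₁≢w₂ ; w₁≢w₃ = w≢w₁ ∘ sym ; w₂≢w₃ = w≢w₂ ∘ sym
        ; neighbour₁ = xw₁ , ch-path Aa Ab σ w₁∈ ; neighbour₂ = xw₂ , ch-path Aa Ab σ w₂∈ ; neighbour₃ = nb })

  Fork-map : ∀ {A B : VSet n} {x} → (∀ {w} → HullNeighbour A x w → HullNeighbour B x w) → Fork A x → Fork B x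
  Fork-map f fork = record
    { w₁≢w₂ = w₁≢w₂ ; w₁≢w₃ = w₁≢w₃ ; w₂≢w₃ = w₂≢w₃
    ; neighbour₁ = f neighbour₁ ; neighbour₂ = f neighbour₂ ; neighbour₃ = f neighbour₃ }
    where open Fork fork

  forkFree-resp : ∀ {A B : VSet n} → (∀ z → A z ⇔ B z) → ForkFree A → ForkFree B
  forkFree-resp {A} {B} A⇔B ff x x∈chB x∉B =
    ff x (ch-mono B⊆A x∈chB) (x∉B ∘ Equivalence.to (A⇔B x)) ∘ Fork-map (λ { (xw , w∈ch) → xw , ch-mono B⊆A w∈ch })
    where
    B⊆A : ∀ {z} → B z → A z
    B⊆A {z} = Equivalence.from (A⇔B z)

  ch-linked : ∀ {A : VSet n} {v w} → w ≢ v → ch S A w → ∃[ a ] (A a × Linked v w a)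
  ch-linked {v = v} {w} w≢v (a , b , vs , Aa , Ab , (π , vs!) , w∈) with split π w∈
  ... | ws₁ , ws₂ , refl , pre , suf with v ∈? (w ∷ ws₂)
  ... | no v∉suf = b , Ab , _ , suf , v∉suf
  ... | yes (here refl) = ⊥-elim (w≢v refl)
  ... | yes (there v∈ws₂) with reverse adj-sym pre
  ...   | ls , pre⁻ , ls⊆ , _ = a , Aa , ls , pre⁻ ,
          λ v∈ls → w≢v (sym (Unique-meet ws₁ vs! (ls⊆ v∈ls) (there v∈ws₂)))

  return-path : ∀ {a m₀ vs us} → Path a m₀ us → m₀ ∈ vs →
                ∃[ m ] ∃[ t ] (m ∈ vs × m ∈ us × SimplePath adj m a (m ∷ t) × All (_∉ vs) t)
  return-path {vs = vs} R m₀∈vs with first-in (_∈? vs) m₀∈vs R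
  ... | m , m∈vs , ws , R' , ws⊆us , only-m with simplify R'
  ... | ws' , R'' , ws'⊆ws with reverse-simple adj-sym R''
  ... | rs , (ρ , rs!) , rs⊆ws' , _ with nodes-start ρ
  ... | t , refl = m , t , m∈vs , ws⊆us (last∈ R') , (ρ , rs!) , All.tabulate t∉vs
    where
    t∉vs : ∀ {z} → z ∈ t → z ∉ vs
    t∉vs z∈t z∈vs = Unique[x∷xs]⇒x∉xs rs! (subst (_∈ t) (only-m (ws'⊆ws (rs⊆ws' (there z∈t))) z∈vs) z∈t)

  tripod⇒fork : ∀ {A : VSet n} {a₁ a₂ a₃ m vs t} → A a₁ → A a₂ → A a₃ → SimplePath adj a₁ a₂ vs →
                m ∈ vs → m ≢ a₁ → m ≢ a₂ → m ≢ a₃ →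
                SimplePath adj m a₃ (m ∷ t) → All (_∉ vs) t → Fork A m
  tripod⇒fork {a₁ = a₁} {a₂} {a₃} {vs = vs} Aa₁ Aa₂ Aa₃ F m∈vs m≢a₁ m≢a₂ m≢a₃ ρ t∉vs
    with path-neighbours adj-sym F m∈vs m≢a₁ m≢a₂ | second-node (proj₁ ρ) m≢a₃ | split (proj₁ F) m∈vs
  ... | w₁ , w₂ , w₁≢w₂ , mw₁ , mw₂ , w₁∈ , w₂∈ | y , my , y∈t | ws₁ , ws₂ , refl , pre , _
    with simplify pre
  ... | ps , P , ps⊆ with join-simple P ρ (λ z∈ps → λ
          { (here z≡m)  → z≡m
          ; (there z∈t) → ⊥-elim (All.lookup t∉vs z∈t (++-[x]-⊆ ws₁ (ps⊆ z∈ps))) })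
  ... | js , J , _ , ⊆js , _ = record
    { w₁≢w₂ = w₁≢w₂
    ; w₁≢w₃ = λ { refl → All.lookup t∉vs y∈t w₁∈ }
    ; w₂≢w₃ = λ { refl → All.lookup t∉vs y∈t w₂∈ }
    ; neighbour₁ = mw₁ , ch-path Aa₁ Aa₂ F w₁∈
    ; neighbour₂ = mw₂ , ch-path Aa₁ Aa₂ F w₂∈
    ; neighbour₃ = my , ch-path Aa₁ Aa₃ J (⊆js (there y∈t)) }

  no-tripod : ∀ {A : VSet n} {a₁ a₂ a₃ m₀ vs us} → ForkFree A → A a₁ → A a₂ → A a₃ →
              SimplePath adj a₁ a₂ vs → Path a₃ m₀ us → m₀ ∈ vs →
              (∀ {z} → z ∈ us → z ∈ vs → ¬ A z) → ⊥
  no-tripod {A} ff Aa₁ Aa₂ Aa₃ F R m₀∈vs shared∉A with return-path R m₀∈vs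
  ... | m , t , m∈vs , m∈us , ρ , t∉vs =
    ff m (ch-path Aa₁ Aa₂ F m∈vs) m∉A
      (tripod⇒fork Aa₁ Aa₂ Aa₃ F m∈vs (λ { refl → m∉A Aa₁ }) (λ { refl → m∉A Aa₂ }) (λ { refl → m∉A Aa₃ })
                   ρ t∉vs)
    where
    m∉A : ¬ A m
    m∉A = shared∉A m∈us m∈vs

  at-most-two-boundary-points : ∀ {A C : VSet n} {a₁ a₂ a₃} → ForkFree A → ConnectedIn S C →
                                (∀ {z} → C z → ¬ A z) →
                                A a₁ → A a₂ → A a₃ → Boundary C a₁ → Boundary C a₂ → Boundary C a₃ →
                                a₁ ≢ a₂ → a₁ ≢ a₃ → a₂ ≢ a₃ → ⊥
  at-most-two-boundary-points {A} {C} {a₁} {a₂} {a₃} ff conn C∌A Aa₁ Aa₂ Aa₃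
    (_ , u₁ , Cu₁ , u₁a₁) (_ , u₂ , Cu₂ , u₂a₂) (_ , u₃ , Cu₃ , u₃a₃) a₁≢a₂ a₁≢a₃ a₂≢a₃
    with conn u₁ u₂ Cu₁ Cu₂ | conn u₃ u₁ Cu₃ Cu₁
  ... | vs , π , vs⊆C | rs , ρ , rs⊆C with simplify π
  ... | ws , (σ , ws!) , ws⊆vs =
    no-tripod ff Aa₁ Aa₂ Aa₃ (F , F!) (step (adj-sym u₃a₃) ρ) (there (∈-++⁺ˡ (head∈ σ))) shared∉A
    where
    inC : ∀ {z} → z ∈ ws → C z
    inC = All.lookup vs⊆C ∘ ws⊆vs
    F : Path a₁ a₂ (a₁ ∷ ws ++ [ a₂ ])
    F = step (adj-sym u₁a₁) (σ ▷ u₂a₂)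
    F! : Unique (a₁ ∷ ws ++ [ a₂ ])
    F! = Unique-∷ ([ (λ a₁∈ws → C∌A (inC a₁∈ws) Aa₁) , a₁≢a₂ ∘ ∈[x]⇒≡ ]′ ∘ ∈-++⁻ ws)
                  (Unique.++⁺ ws! Unique-[x] λ { (z∈ws , here refl) → C∌A (inC z∈ws) Aa₂ })
    shared∉A : ∀ {z} → z ∈ a₃ ∷ rs → z ∈ a₁ ∷ ws ++ [ a₂ ] → ¬ A z
    shared∉A (there z∈rs) _                    = C∌A (All.lookup rs⊆C z∈rs)
    shared∉A (here refl)  (here a₃≡a₁)         = λ _ → a₁≢a₃ (sym a₃≡a₁)
    shared∉A (here refl)  (there a₃∈)          =
      [ C∌A ∘ inC , (λ a₃∈a₂ _ → a₂≢a₃ (sym (∈[x]⇒≡ a₃∈a₂))) ]′ (∈-++⁻ ws a₃∈)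

  CutPoint : VSet n → VSet n → V → VSet n
  CutPoint A B w z = B z ⊎ (A z × ∃[ vs ] (Path w z vs × All (∁ B) vs))

  cut-at-first : ∀ {A B : VSet n} {w c us} → Decidable B → A c → Path w c us →
                 ∃[ z ] (CutPoint A B w z × ∃[ ws ] (Path w z ws × ws ⊆ us))
  cut-at-first {B = B} {c = c} B? Ac ρ with first-in (λ z → B? z ⊎-dec (z ≟ c)) (inj₂ refl) ρ
  ... | z , inj₁ Bz , ws , σ , ws⊆ , _ = z , inj₁ Bz , ws , σ , ws⊆
  ... | z , inj₂ refl , ws , σ , ws⊆ , only-z with B? z
  ...   | yes Bz = z , inj₁ Bz , ws , σ , ws⊆
  ...   | no ¬Bz =
    z , inj₂ (Ac , ws , σ , All.tabulate λ x∈ Bx → ¬Bz (subst B (only-z x∈ (inj₁ Bx)) Bx)) , ws , σ , ws⊆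

  hull-cut : ∀ {A B : VSet n} {w} → Decidable B → ch S A w → ch S (CutPoint A B w) w
  hull-cut B? (a , b , vs , Aa , Ab , (π , vs!) , w∈)
    with split π w∈
  ... | ws₁ , ws₂ , refl , pre , suf with reverse adj-sym pre
  ... | ls , pre⁻ , ls⊆ , _ with cut-at-first B? Aa pre⁻ | cut-at-first B? Ab suf
  ... | z₁ , Cz₁ , ls' , σ₁ , ls'⊆ | z₂ , Cz₂ , rs , σ₂ , rs⊆ with simplify σ₁ | simplify σ₂
  ... | ls'' , σ₁' , ls''⊆ | rs' , σ₂' , rs'⊆ with reverse-simple adj-sym σ₁'
  ... | ks , σ₁⁻ , ks⊆ , _ with join-simple σ₁⁻ σ₂' (λ z∈ks z∈rs' →
          Unique-meet ws₁ vs! (ls⊆ (ls'⊆ (ls''⊆ (ks⊆ z∈ks)))) (rs⊆ (rs'⊆ z∈rs')))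
  ... | us , σ , ks⊆us , _ = z₁ , z₂ , us , Cz₁ , Cz₂ , σ , ks⊆us (last∈ (proj₁ σ₁⁻))

  Boundary-dec : ∀ {D : VSet n} → Decidable D → Decidable (Boundary D)
  Boundary-dec D? x = ¬? (D? x) ×-dec any? (λ u → D? u ×-dec adj? u x)

  module _ {A B D : VSet n} (D? : Decidable D) (∂D⊆B : ∀ {z} → Boundary D z → B z) where

    hull-inside : (∀ {z} → A z → D z → B z) → ∀ {w} → D w → ch S A w → ch S B w
    hull-inside A∩D⊆B Dw w∈ch = ch-mono
      [ ∂D⊆B , (λ { (Az , _ , π , avoids) → A∩D⊆B Az (stays-in D? Dw π avoids) }) ]′
      (hull-cut (Boundary-dec D?) w∈ch)

    hull-outside : (∀ {z} → A z → ¬ D z → B z) → ∀ {w} → ¬ D w → ch S A w → ch S B w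
    hull-outside A∖D⊆B ¬Dw w∈ch = ch-mono
      [ ∂D⊆B , (λ { (Az , _ , π , avoids) → A∖D⊆B Az (stays-out adj-sym D? ¬Dw π avoids) }) ]′
      (hull-cut (Boundary-dec D?) w∈ch)

module SearchTree {n : ℕ} (S : UTree n) (par : Parent n) (stt : IsSTT S par) where

  open UTree S renaming (sym to adj-sym)
  open Hull S

  private
    V = Fin n

  -- In names, y↑z stands for Anc par y z (z lies on the root path of y) and z∈Ty for Sub par y z.

  root : V
  root = proj₁ (proj₁ stt)

  root-parent : par root ≡ nothing
  root-parent = proj₁ (proj₂ (proj₁ stt))

  to-root : ∀ x → Anc par x root
  to-root = proj₂ (proj₂ (proj₁ stt))

  has-parent⇒¬root : ∀ {x z} → par x ≡ nothing → par x ≡ just z → ⊥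
  has-parent⇒¬root px≡nothing px≡just with trans (sym px≡nothing) px≡just
  ... | ()

  subtree-separated : ∀ {y c} → par c ≡ just y →
                      ∀ u w → Sub par c u → Sub par y w → w ≢ y → ¬ Sub par c w → ¬ adj u w
  subtree-separated {y} {c} pc = proj₂ (proj₂ stt y c pc)

  Anc-trans : ∀ {x y z} → Anc par x y → Anc par y z → Anc par x z
  Anc-trans self       yz = yz
  Anc-trans (up px xy) yz = up px (Anc-trans xy yz)

  parent⇒Anc : ∀ {x y} → par x ≡ just y → Anc par x y
  parent⇒Anc px = up px self

  Anc-total : ∀ {x a b} → Anc par x a → Anc par x b → Anc par a b ⊎ Anc par b a
  Anc-total self       xb          = inj₁ xb
  Anc-total (up px xa) self        = inj₂ (up px xa)
  Anc-total (up px xa) (up px' xb) with just-injective (trans (sym px) px')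
  ... | refl = Anc-total xa xb

  root-below : ∀ {r} → par r ≡ nothing → ∀ x → Anc par x r
  root-below {r} pr x with to-root r
  ... | self     = to-root x
  ... | up pr' _ = ⊥-elim (has-parent⇒¬root pr pr')

  Cycle : V → Set
  Cycle x = ∃[ z ] (par x ≡ just z × Anc par z x)

  cycle-up : ∀ {x w} → Cycle x → Anc par x w → Cycle w
  cycle-up c                  self       = c
  cycle-up {x} (z , pxz , zx) (up pxz' zw) with just-injective (trans (sym pxz) pxz')
  ... | refl = cycle-up (rotate zx) zw
    where
    rotate : Anc par z x → Cycle z
    rotate self        = z , pxz , self
    rotate (up pz z'x) = _ , pz , Anc-trans z'x (parent⇒Anc pxz)

  no-cycle : ∀ {x} → ¬ Cycle x
  no-cycle {x} c with cycle-up c (to-root x)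
  ... | _ , proot , _ = has-parent⇒¬root root-parent proot

  parent-not-below : ∀ {x y} → par x ≡ just y → ¬ Anc par y x
  parent-not-below px yx = no-cycle (_ , px , yx)

  Anc-antisym : ∀ {x y} → Anc par x y → Anc par y x → x ≡ y
  Anc-antisym self       _  = refl
  Anc-antisym (up px xy) yx = ⊥-elim (parent-not-below px (Anc-trans xy yx))

  Anc-dec : ∀ x y → Dec (Anc par x y)
  Anc-dec x y = search (to-root x)
    where
    search : ∀ {z} → Anc par z root → Dec (Anc par z y)
    search {z} z↑ with z ≟ y
    ... | yes refl = yes self
    search {z} self        | no z≢y = no λ { self → z≢y refl ; (up pr _) → has-parent⇒¬root root-parent pr }
    search {z} (up pz z'↑) | no z≢y with search z'↑
    ... | yes z'y = yes (up pz z'y)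
    ... | no ¬z'y = no λ
      { self          → z≢y refl
      ; (up pz' z''y) → ¬z'y (subst (λ a → Anc par a y) (just-injective (trans (sym pz') pz)) z''y) }

  subtree-dec : ∀ y → Decidable (Sub par y)
  subtree-dec y x = Anc-dec x y

  δ-dec : ∀ y → Decidable (δ S par y)
  δ-dec y = Boundary-dec (subtree-dec y)

  subtree-connected : ∀ y → ConnectedIn S (Sub par y)
  subtree-connected y with par y in py
  ... | just z  = proj₁ (proj₂ stt z y py)
  ... | nothing = λ u w _ _ →
    let (vs , π) = connected u w in vs , π , All.tabulate (λ {x} _ → root-below py x)

  -- Climb from z to the root: whenever c' is the parent of c and e ∈ T_c', separation of T_c inside
  -- T_c' forces e ∈ T_c or e = c'.
  boundary⇒ancestor : ∀ {z e} → δ S par z e → Anc par z e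
  boundary⇒ancestor {z} {e} (e∉Tz , u , u∈Tz , ue) =
    climb self (⊥-elim ∘ e∉Tz) (to-root z) (to-root e)
    where
    climb : ∀ {c a} → Anc par z c → (Anc par e c → Anc par z e) → Anc par c a → Anc par e a → Anc par z e
    climb zc below-c self        ea = below-c ea
    climb {c} zc below-c (up {z = c'} pc c'a) ea = climb (Anc-trans zc (parent⇒Anc pc)) below-c' c'a ea
      where
      below-c' : Anc par e c' → Anc par z e
      below-c' ec' with Anc-dec e c | e ≟ c'
      ... | yes ec | _        = below-c ec
      ... | no _   | yes refl = Anc-trans zc (parent⇒Anc pc)
      ... | no ¬ec | no e≢c'  = ⊥-elim (subtree-separated pc u e (Anc-trans u∈Tz zc) ec' e≢c' ¬ec ue)

  boundary⇒above-parent : ∀ {z e} → δ S par z e → ∃[ r ] (par z ≡ just r × Anc par r e)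
  boundary⇒above-parent ∂e@(e∉Tz , _) with boundary⇒ancestor ∂e
  ... | self      = ⊥-elim (e∉Tz self)
  ... | up pz r↑e = _ , pz , r↑e

  parent∈boundary : ∀ {c y} → par c ≡ just y → δ S par c y
  parent∈boundary {c} {y} pc with subtree-connected y c y (parent⇒Anc pc) self
  ... | vs , π , vs⊆Ty with first-exit (subtree-dec c) self (parent-not-below pc) π
  ... | e , ∂e , ws , ρ , ws⊆vs with boundary⇒above-parent ∂e
  ... | r , pc' , r↑e with just-injective (trans (sym pc) pc')
  ... | refl = subst (δ S par c) (Anc-antisym (All.lookup vs⊆Ty (ws⊆vs (last∈ ρ))) r↑e) ∂e

module Rotation {n : ℕ} (S : UTree n) (par : Parent n) (stt : IsSTT S par)
                (q p : Fin n) (pq : par q ≡ just p) (par' : Parent n) (rot : IsRotation S par q p par') where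

  open UTree S renaming (sym to adj-sym)
  open Hull S
  open SearchTree S par stt

  private
    V = Fin n

  par'-q : par' q ≡ par p
  par'-q = proj₁ rot

  par'-p : par' p ≡ just q
  par'-p = proj₁ (proj₂ rot)

  Moves : V → Set
  Moves m = par m ≡ just q × ∃[ u ] (Sub par m u × adj u p)

  Moves-dec : Decidable Moves
  Moves-dec m = ≡-dec _≟_ (par m) (just q) ×-dec any? (λ u → Anc-dec u m ×-dec adj? u p)

  par'-moves : ∀ {x} → x ≢ q → x ≢ p → Moves x → par' x ≡ just p
  par'-moves x≢q x≢p = proj₁ (proj₂ (proj₂ rot) _ x≢q x≢p)

  par'-stays : ∀ {x} → x ≢ q → x ≢ p → ¬ Moves x → par' x ≡ par x
  par'-stays x≢q x≢p = proj₂ (proj₂ (proj₂ rot) _ x≢q x≢p)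

  q↑p : Anc par q p
  q↑p = parent⇒Anc pq

  p∉Tq : ¬ Anc par p q
  p∉Tq = parent-not-below pq

  q≢p : q ≢ p
  q≢p refl = p∉Tq self

  LosesP : V → Set
  LosesP y = Anc par y q × ¬ (∃[ m ] (Moves m × Anc par y m))

  GainsQ : V → Set
  GainsQ y = Anc par y p × ¬ Anc par y q

  -- Root paths after the rotation: T_p ∖ T_q gains q, and the part of T_q not moved below p loses p.
  AncAfter : V → V → Set
  AncAfter y z = (Anc par y z × ¬ (z ≡ p × LosesP y)) ⊎ (z ≡ q × GainsQ y)

  LosesP-dec : Decidable LosesP
  LosesP-dec y = Anc-dec y q ×-dec ¬? (any? (λ m → Moves-dec m ×-dec Anc-dec y m))

  GainsQ-dec : Decidable GainsQ
  GainsQ-dec y = Anc-dec y p ×-dec ¬? (Anc-dec y q)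

  LosesP-q : LosesP q
  LosesP-q = self , λ { (_ , (pm , _) , q↑m) → parent-not-below pm q↑m }

  ¬LosesP-p : ¬ LosesP p
  ¬LosesP-p (p↑q , _) = p∉Tq p↑q

  ¬LosesP-above-p : ∀ {r} → par p ≡ just r → ¬ LosesP r
  ¬LosesP-above-p pr (r↑q , _) = parent-not-below pr (Anc-trans r↑q q↑p)

  LosesP-up : ∀ {y w} → y ≢ q → ¬ Moves y → par y ≡ just w → LosesP y → LosesP w
  LosesP-up y≢q _ _ (self , _) = ⊥-elim (y≢q refl)
  LosesP-up y≢q _ py (up py' w↑q , no-move) with just-injective (trans (sym py) py')
  ... | refl = w↑q , λ { (m , mv , w↑m) → no-move (m , mv , up py w↑m) }

  LosesP-down : ∀ {y w} → ¬ Moves y → par y ≡ just w → LosesP w → LosesP y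
  LosesP-down ¬mv py (w↑q , no-move) = up py w↑q , λ
    { (m , mv , self)       → ¬mv mv
    ; (m , mv , up py' w↑m) → no-move (m , mv , subst (λ a → Anc par a m) (just-injective (trans (sym py') py)) w↑m) }

  AncAfter-step : ∀ y {w z} → par' y ≡ just w → AncAfter w z → AncAfter y z
  AncAfter-step y {w} {z} py with y ≟ q | y ≟ p
  ... | yes refl | _ = from-q (trans (sym par'-q) py)
    where
    from-q : par p ≡ just w → AncAfter w z → AncAfter q z
    from-q pp (inj₁ (w↑z , _))     = inj₁ (up pq (up pp w↑z) , λ { (refl , _) → parent-not-below pp w↑z })
    from-q pp (inj₂ (_ , w↑p , _)) = ⊥-elim (parent-not-below pp w↑p)
  ... | no _ | yes refl with just-injective (trans (sym py) par'-p)
  ...   | refl = from-p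
    where
    from-p : AncAfter q z → AncAfter p z
    from-p (inj₁ (self , _))          = inj₂ (refl , self , p∉Tq)
    from-p (inj₁ (up pq' p↑z , _)) with just-injective (trans (sym pq') pq)
    ... | refl = inj₁ (p↑z , λ { (_ , lp) → ¬LosesP-p lp })
    from-p (inj₂ (_ , _ , q∉Tq))      = ⊥-elim (q∉Tq self)
  AncAfter-step y {w} {z} py | no y≢q | no y≢p with Moves-dec y
  ... | yes mv with just-injective (trans (sym py) (par'-moves y≢q y≢p mv))
  ...   | refl = from-moved
    where
    from-moved : AncAfter p z → AncAfter y z
    from-moved (inj₁ (p↑z , _))  = inj₁ (up (proj₁ mv) (up pq p↑z) , λ { (_ , _ , no-move) → no-move (y , mv , self) })
    from-moved (inj₂ (refl , _)) = inj₁ (parent⇒Anc (proj₁ mv) , λ { (q≡p , _) → q≢p q≡p })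
  AncAfter-step y {w} {z} py | no y≢q | no y≢p | no ¬mv = from-parent (trans (sym (par'-stays y≢q y≢p ¬mv)) py)
    where
    from-parent : par y ≡ just w → AncAfter w z → AncAfter y z
    from-parent pyw (inj₁ (w↑z , ok)) = inj₁ (up pyw w↑z , λ { (refl , lp) → ok (refl , LosesP-up y≢q ¬mv pyw lp) })
    from-parent pyw (inj₂ (refl , w↑p , w∉Tq)) = inj₂ (refl , up pyw w↑p , y∉Tq)
      where
      y∉Tq : ¬ Anc par y q
      y∉Tq self          = y≢q refl
      y∉Tq (up py' w'↑q) = w∉Tq (subst (λ a → Anc par a q) (just-injective (trans (sym py') pyw)) w'↑q)

  Anc'⇒AncAfter : ∀ {y z} → Anc par' y z → AncAfter y z
  Anc'⇒AncAfter self        = inj₁ (self , λ { (refl , lp) → ¬LosesP-p lp })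
  Anc'⇒AncAfter {y} (up py d) = AncAfter-step y py (Anc'⇒AncAfter d)

  kept : ∀ {y z} → Anc par y z → ¬ (z ≡ p × LosesP y) → Anc par' y z
  kept-from-q : ∀ {z} → Anc par p z → ¬ (z ≡ p × LosesP q) → Anc par' q z
  kept-from-p : ∀ {w z} → par p ≡ just w → Anc par w z → Anc par' p z
  kept-from-moved : ∀ {y z} → y ≢ q → y ≢ p → Moves y → Anc par q z → Anc par' y z

  kept self _ = self
  kept {y} (up py y'↑z) ok with y ≟ q | y ≟ p
  ... | yes refl | _ with just-injective (trans (sym py) pq)
  ...   | refl = kept-from-q y'↑z ok
  kept (up py y'↑z) ok | no _ | yes refl = kept-from-p py y'↑z
  kept {y} (up py y'↑z) ok | no y≢q | no y≢p with Moves-dec y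
  ... | yes mv with just-injective (trans (sym py) (proj₁ mv))
  ...   | refl = kept-from-moved y≢q y≢p mv y'↑z
  kept (up py y'↑z) ok | no y≢q | no y≢p | no ¬mv =
    up (trans (par'-stays y≢q y≢p ¬mv) py) (kept y'↑z λ { (z≡p , lp) → ok (z≡p , LosesP-down ¬mv py lp) })

  kept-from-q self          ok = ⊥-elim (ok (refl , LosesP-q))
  kept-from-q (up pp r↑z) _  = up (trans par'-q pp) (kept r↑z λ { (_ , lp) → ¬LosesP-above-p pp lp })

  kept-from-p pp r↑z = up par'-p (up (trans par'-q pp) (kept r↑z λ { (_ , lp) → ¬LosesP-above-p pp lp }))

  kept-from-moved y≢q y≢p mv self = up (par'-moves y≢q y≢p mv) (up par'-p self)
  kept-from-moved y≢q y≢p mv (up pq' p↑z) with just-injective (trans (sym pq) pq')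
  kept-from-moved y≢q y≢p mv (up _ self)        | refl = up (par'-moves y≢q y≢p mv) self
  kept-from-moved y≢q y≢p mv (up _ (up pp r↑z)) | refl = up (par'-moves y≢q y≢p mv) (kept-from-p pp r↑z)

  gained : ∀ {y} → Anc par y p → ¬ Anc par y q → Anc par' y q
  gained self        _    = up par'-p self
  gained {y} (up py y'↑p) y∉Tq with y ≟ p
  ... | yes refl = up par'-p self
  ... | no y≢p   = up (trans (par'-stays (λ { refl → y∉Tq self }) y≢p (λ mv → y∉Tq (parent⇒Anc (proj₁ mv)))) py)
                      (gained y'↑p (y∉Tq ∘ up py))

  AncAfter⇔Anc' : ∀ y z → AncAfter y z ⇔ Anc par' y z
  AncAfter⇔Anc' y z = mk⇔
    (λ { (inj₁ (y↑z , ok)) → kept y↑z ok ; (inj₂ (refl , y↑p , y∉Tq)) → gained y↑p y∉Tq })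
    Anc'⇒AncAfter

  Anc∪q : V → VSet n
  Anc∪q y z = Anc par y z ⊎ z ≡ q

  Anc∖p : V → VSet n
  Anc∖p y z = Anc par y z × z ≢ p

  RotationCondition : Set
  RotationCondition = ¬ HasSize (δ S par p) 2 ⊎ ¬ HasSize (δ S par q) 1

  boundary-of-q⇒above-p : ∀ {e} → δ S par q e → Anc par p e
  boundary-of-q⇒above-p ∂e with boundary⇒above-parent ∂e
  ... | r , pq' , r↑e with just-injective (trans (sym pq) pq')
  ... | refl = r↑e

  module _ (sc : SteinerClosed S par) where

    ancestors-forkFree : ∀ y → ForkFree (Anc par y)
    ancestors-forkFree y = steinerClosed⇒forkFree (sc y)

    boundary-of-p-¬three : ∀ {e₁ e₂ e₃} → δ S par p e₁ → δ S par p e₂ → δ S par p e₃ →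
                           e₁ ≢ e₂ → e₁ ≢ e₃ → e₂ ≢ e₃ → ⊥
    boundary-of-p-¬three ∂₁ ∂₂ ∂₃
      with boundary⇒above-parent ∂₁ | boundary⇒above-parent ∂₂ | boundary⇒above-parent ∂₃
    ... | r , pp , r↑e₁ | _ , pp₂ , r↑e₂ | _ , pp₃ , r↑e₃
      with just-injective (trans (sym pp) pp₂) | just-injective (trans (sym pp) pp₃)
    ... | refl | refl =
      at-most-two-boundary-points (ancestors-forkFree r) (subtree-connected p)
        (λ z∈Tp r↑z → parent-not-below pp (Anc-trans r↑z z∈Tp)) r↑e₁ r↑e₂ r↑e₃ ∂₁ ∂₂ ∂₃

    Anchor : VSet n
    Anchor z = Sub par q z ⊎ δ S par p z

    anchor≢p : ∀ {z} → Anchor z → z ≢ p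
    anchor≢p (inj₁ z∈Tq)      refl = p∉Tq z∈Tq
    anchor≢p (inj₂ (p∉Tp , _)) refl = p∉Tp self

    unlinked⇒≢ : ∀ {z z'} → Anchor z → ¬ Linked p z z' → z ≢ z'
    unlinked⇒≢ az z≁z' refl = z≁z' (Linked-refl (anchor≢p az))

    Tq-linked : ∀ {k k'} → Sub par q k → Sub par q k' → Linked p k k'
    Tq-linked k∈Tq k'∈Tq with subtree-connected q _ _ k∈Tq k'∈Tq
    ... | vs , π , vs⊆Tq = vs , π , p∉Tq ∘ All.lookup vs⊆Tq

    anchor-of : ∀ {B : VSet n} {w} → (∀ {z} → B z → Sub par q z ⊎ ¬ Sub par p z) → adj p w → ch S B w →
                ∃[ z ] (Anchor z × Linked p w z)
    anchor-of {w = w} B-sides pw w∈ch with ch-linked (adj⇒≢ pw) w∈ch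
    ... | c , Bc , w~c with B-sides Bc | subtree-dec p w
    ... | inj₁ c∈Tq | _         = c , inj₁ c∈Tq , w~c
    ... | inj₂ _    | no w∉Tp   = w , inj₂ (w∉Tp , p , self , pw) , Linked-refl (adj⇒≢ pw)
    ... | inj₂ c∉Tp | yes w∈Tp with first-exit (subtree-dec p) w∈Tp c∉Tp (proj₁ (proj₂ w~c))
    ...   | e , ∂e , ws , ρ , ws⊆ = e , inj₂ ∂e , ws , ρ , proj₂ (proj₂ w~c) ∘ ws⊆

    boundary-of-p-pair : ∀ {e e'} → δ S par p e → δ S par p e' → e ≢ e' → HasSize (δ S par p) 2
    boundary-of-p-pair ∂e ∂e' e≢e' =
      noThird⇒HasSize-2 ∂e ∂e' e≢e' λ ∂f f≢e f≢e' →
        boundary-of-p-¬three ∂e ∂e' ∂f e≢e' (f≢e ∘ sym) (f≢e' ∘ sym)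

    linked-boundary-of-q : ¬ HasSize (δ S par q) 1 → ∀ {k} → Sub par q k → ∃[ f ] (δ S par p f × Linked p k f)
    linked-boundary-of-q ¬|δq|≡1 k∈Tq with HasSize-1⊎another (δ-dec q) (parent∈boundary pq)
    ... | inj₁ |δq|≡1 = ⊥-elim (¬|δq|≡1 |δq|≡1)
    ... | inj₂ (f , ∂f@(f∉Tq , v , v∈Tq , vf) , f≢p) =
      f , ((λ f∈Tp → f≢p (Anc-antisym f∈Tp (boundary-of-q⇒above-p ∂f))) , v , Anc-trans v∈Tq q↑p , vf) ,
      Linked-trans (Tq-linked k∈Tq v∈Tq) (Linked-adj vf (λ { refl → p∉Tq v∈Tq }) f≢p)

    -- With δ(T_p) = {e, e'}, the condition can only hold through a boundary point of T_q other than
    -- p; that point lies in δ(T_p) and is linked to T_q.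
    one-anchor-in-Tq : RotationCondition → ∀ {k e e'} → Sub par q k → δ S par p e → δ S par p e' →
                       ¬ Linked p e e' → ¬ Linked p k e → ¬ Linked p k e' → ⊥
    one-anchor-in-Tq (inj₁ ¬|δp|≡2) _ ∂e ∂e' e≁e' _ _ =
      ¬|δp|≡2 (boundary-of-p-pair ∂e ∂e' (unlinked⇒≢ (inj₂ ∂e) e≁e'))
    one-anchor-in-Tq (inj₂ ¬|δq|≡1) {k} {e} {e'} k∈Tq ∂e ∂e' e≁e' k≁e k≁e'
      with linked-boundary-of-q ¬|δq|≡1 k∈Tq
    ... | f , ∂f , k~f with f ≟ e | f ≟ e'
    ...   | yes refl | _        = k≁e k~f
    ...   | no _     | yes refl = k≁e' k~f
    ...   | no f≢e   | no f≢e'  =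
      boundary-of-p-¬three ∂e ∂e' ∂f (unlinked⇒≢ (inj₂ ∂e) e≁e') (f≢e ∘ sym) (f≢e' ∘ sym)

    anchors-¬three : RotationCondition → ∀ {z₁ z₂ z₃} → Anchor z₁ → Anchor z₂ → Anchor z₃ →
                     ¬ Linked p z₁ z₂ → ¬ Linked p z₁ z₃ → ¬ Linked p z₂ z₃ → ⊥
    anchors-¬three _ (inj₁ k₁) (inj₁ k₂) _         z₁≁z₂ _     _     = z₁≁z₂ (Tq-linked k₁ k₂)
    anchors-¬three _ (inj₁ k₁) _         (inj₁ k₃) _     z₁≁z₃ _     = z₁≁z₃ (Tq-linked k₁ k₃)
    anchors-¬three _ _         (inj₁ k₂) (inj₁ k₃) _     _     z₂≁z₃ = z₂≁z₃ (Tq-linked k₂ k₃)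
    anchors-¬three _ (inj₂ ∂₁) (inj₂ ∂₂) (inj₂ ∂₃) z₁≁z₂ z₁≁z₃ z₂≁z₃ =
      boundary-of-p-¬three ∂₁ ∂₂ ∂₃
        (unlinked⇒≢ (inj₂ ∂₁) z₁≁z₂) (unlinked⇒≢ (inj₂ ∂₁) z₁≁z₃) (unlinked⇒≢ (inj₂ ∂₂) z₂≁z₃)
    anchors-¬three cond (inj₁ k) (inj₂ ∂₂) (inj₂ ∂₃) z₁≁z₂ z₁≁z₃ z₂≁z₃ =
      one-anchor-in-Tq cond k ∂₂ ∂₃ z₂≁z₃ z₁≁z₂ z₁≁z₃
    anchors-¬three cond (inj₂ ∂₁) (inj₁ k) (inj₂ ∂₃) z₁≁z₂ z₁≁z₃ z₂≁z₃ =
      one-anchor-in-Tq cond k ∂₁ ∂₃ z₁≁z₃ (z₁≁z₂ ∘ Linked-sym) z₂≁z₃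
    anchors-¬three cond (inj₂ ∂₁) (inj₂ ∂₂) (inj₁ k) z₁≁z₂ z₁≁z₃ z₂≁z₃ =
      one-anchor-in-Tq cond k ∂₁ ∂₂ z₁≁z₂ (z₁≁z₃ ∘ Linked-sym) (z₂≁z₃ ∘ Linked-sym)

    p-forkFree : RotationCondition → ∀ {B : VSet n} → (∀ {z} → B z → Sub par q z ⊎ ¬ Sub par p z) → ¬ Fork B p
    p-forkFree cond B-sides record
      { w₁≢w₂ = w₁≢w₂ ; w₁≢w₃ = w₁≢w₃ ; w₂≢w₃ = w₂≢w₃
      ; neighbour₁ = pw₁ , w₁∈ch ; neighbour₂ = pw₂ , w₂∈ch ; neighbour₃ = pw₃ , w₃∈ch }
      with anchor-of B-sides pw₁ w₁∈ch | anchor-of B-sides pw₂ w₂∈ch | anchor-of B-sides pw₃ w₃∈ch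
    ... | _ , a₁ , w₁~z₁ | _ , a₂ , w₂~z₂ | _ , a₃ , w₃~z₃ = anchors-¬three cond a₁ a₂ a₃
      (neighbours-unlinked-via w₁≢w₂ pw₁ pw₂ w₁~z₁ w₂~z₂)
      (neighbours-unlinked-via w₁≢w₃ pw₁ pw₃ w₁~z₁ w₃~z₃)
      (neighbours-unlinked-via w₂≢w₃ pw₂ pw₃ w₂~z₂ w₃~z₃)

    gains-q-forkFree : ∀ {y} → GainsQ y → ForkFree (Anc∪q y)
    gains-q-forkFree {y} (y↑p , y∉Tq) x x∈ch x∉A fork with subtree-dec q x
    ... | no x∉Tq = ancestors-forkFree y x (outside x∉Tq x∈ch) (x∉A ∘ inj₁) (Fork-map neighbour fork)
      where
      ∂Tq⊆Py : ∀ {e} → δ S par q e → Anc par y e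
      ∂Tq⊆Py ∂e = Anc-trans y↑p (boundary-of-q⇒above-p ∂e)
      outside : ∀ {w} → ¬ Sub par q w → ch S (Anc∪q y) w → ch S (Anc par y) w
      outside = hull-outside (subtree-dec q) ∂Tq⊆Py
        λ { (inj₁ y↑z) _ → y↑z ; (inj₂ refl) q∉Tq → ⊥-elim (q∉Tq self) }
      neighbour : ∀ {w} → HullNeighbour (Anc∪q y) x w → HullNeighbour (Anc par y) x w
      neighbour {w} (xw , w∈ch) with subtree-dec q w
      ... | yes w∈Tq = ⊥-elim (x∉A (inj₁ (∂Tq⊆Py (x∉Tq , w , w∈Tq , adj-sym xw))))
      ... | no w∉Tq  = xw , outside w∉Tq w∈ch
    ... | yes x∈Tq = ancestors-forkFree q x (inside x∈Tq x∈ch) x∉Pq (Fork-map neighbour fork)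
      where
      inside : ∀ {w} → Sub par q w → ch S (Anc∪q y) w → ch S (Anc par q) w
      inside = hull-inside (subtree-dec q) boundary⇒ancestor
        λ { (inj₁ y↑z) z∈Tq → ⊥-elim (y∉Tq (Anc-trans y↑z z∈Tq)) ; (inj₂ refl) _ → self }
      x∉Pq : ¬ Anc par q x
      x∉Pq q↑x = x∉A (inj₂ (Anc-antisym x∈Tq q↑x))
      neighbour : ∀ {w} → HullNeighbour (Anc∪q y) x w → HullNeighbour (Anc par q) x w
      neighbour {w} (xw , w∈ch) with subtree-dec q w
      ... | yes w∈Tq = xw , inside w∈Tq w∈ch
      ... | no w∉Tq  = xw , ch-⊇ (boundary⇒ancestor (w∉Tq , x , x∈Tq , xw))

    loses-p-forkFree : RotationCondition → ∀ {y} → LosesP y → ForkFree (Anc∖p y)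
    loses-p-forkFree cond {y} (y↑q , _) x x∈ch x∉A fork with x ≟ p
    ... | yes refl = p-forkFree cond sides fork
      where
      sides : ∀ {z} → Anc∖p y z → Sub par q z ⊎ ¬ Sub par p z
      sides (y↑z , z≢p) with Anc-total y↑q y↑z
      ... | inj₂ z∈Tq         = inj₁ z∈Tq
      ... | inj₁ self         = inj₁ self
      ... | inj₁ (up pq' p↑z) with just-injective (trans (sym pq) pq')
      ...   | refl = inj₂ λ z∈Tp → z≢p (Anc-antisym z∈Tp p↑z)
    ... | no x≢p = ancestors-forkFree y x (ch-mono proj₁ x∈ch) (λ y↑x → x∉A (y↑x , x≢p))
                     (Fork-map (λ { (xw , w∈ch) → xw , ch-mono proj₁ w∈ch }) fork)

    after-forkFree : RotationCondition → ∀ y → ForkFree (AncAfter y)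
    after-forkFree cond y with GainsQ-dec y | LosesP-dec y
    ... | yes gains | _ = forkFree-resp (λ z → mk⇔
          (λ { (inj₁ y↑z) → inj₁ (y↑z , λ { (_ , y↑q , _) → proj₂ gains y↑q })
             ; (inj₂ refl) → inj₂ (refl , gains) })
          (λ { (inj₁ (y↑z , _)) → inj₁ y↑z ; (inj₂ (refl , _)) → inj₂ refl }))
        (gains-q-forkFree gains)
    ... | no ¬gains | yes loses = forkFree-resp (λ z → mk⇔
          (λ { (y↑z , z≢p) → inj₁ (y↑z , λ { (z≡p , _) → z≢p z≡p }) })
          (λ { (inj₁ (y↑z , ok)) → y↑z , λ z≡p → ok (z≡p , loses)
             ; (inj₂ (_ , gains))   → ⊥-elim (¬gains gains) }))
        (loses-p-forkFree cond loses)
    ... | no ¬gains | no ¬loses = forkFree-resp (λ z → mk⇔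
          (λ y↑z → inj₁ (y↑z , λ { (_ , loses) → ¬loses loses }))
          (λ { (inj₁ (y↑z , _)) → y↑z ; (inj₂ (_ , gains)) → ⊥-elim (¬gains gains) }))
        (ancestors-forkFree y)

    sufficiency : RotationCondition → SteinerClosed S par'
    sufficiency cond y = forkFree⇒steinerClosed (forkFree-resp (AncAfter⇔Anc' y) (after-forkFree cond y))

  Anc'-q⇔Anc∖p : ∀ z → Anc par' q z ⇔ Anc∖p q z
  Anc'-q⇔Anc∖p z = mk⇔
    (after-q ∘ Anc'⇒AncAfter)
    (λ { (q↑z , z≢p) → kept q↑z λ { (z≡p , _) → z≢p z≡p } })
    where
    after-q : AncAfter q z → Anc∖p q z
    after-q (inj₁ (q↑z , ok))     = q↑z , λ z≡p → ok (z≡p , LosesP-q)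
    after-q (inj₂ (_ , _ , q∉Tq)) = ⊥-elim (q∉Tq self)

  Tp∖Tq∩Pq⊆p : ∀ {z} → Sub par p z → ¬ Sub par q z → Anc par q z → z ≡ p
  Tp∖Tq∩Pq⊆p z∈Tp z∉Tq self = ⊥-elim (z∉Tq self)
  Tp∖Tq∩Pq⊆p z∈Tp z∉Tq (up pq' p↑z) with just-injective (trans (sym pq) pq')
  ... | refl = Anc-antisym z∈Tp p↑z

  route-to-p : HasSize (δ S par q) 1 → ∀ {d} → δ S par p d →
               ∃[ rs ] (SimplePath adj d p (d ∷ rs) × All (λ z → Sub par p z × ¬ Sub par q z) rs)
  route-to-p |δq|≡1 {d} ∂d@(d∉Tp , u , u∈Tp , ud) with subtree-connected p u p u∈Tp self
  ... | vs , π , vs⊆Tp with simplify π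
  ... | rs , (σ , rs!) , rs⊆vs =
    rs , (step (adj-sym ud) σ , Unique-∷ (d∉Tp ∘ in-Tp) rs!) ,
    All.zip (All.tabulate in-Tp , stays-out-until-boundary adj-sym (subtree-dec q) u∉Tq (σ , rs!) only-p)
    where
    in-Tp : ∀ {z} → z ∈ rs → Sub par p z
    in-Tp = All.lookup vs⊆Tp ∘ rs⊆vs
    only-p : ∀ {b} → δ S par q b → b ≡ p
    only-p ∂b = HasSize-1⇒≡ |δq|≡1 (parent∈boundary pq) ∂b
    u∉Tq : ¬ Sub par q u
    u∉Tq u∈Tq = d∉Tp (subst (Sub par p) (sym d≡p) self)
      where
      d≡p : d ≡ p
      d≡p = only-p ((λ d∈Tq → d∉Tp (Anc-trans d∈Tq q↑p)) , u , u∈Tq , ud)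

  path-from-q-to-p : ∃[ ps ] (SimplePath adj q p ps × All (λ z → Sub par q z ⊎ z ≡ p) ps)
  path-from-q-to-p with parent∈boundary pq
  ... | _ , v , v∈Tq , vp with subtree-connected q q v self v∈Tq
  ... | vs , π , vs⊆Tq with simplify π
  ... | qs , (σ , qs!) , qs⊆vs =
    qs ++ [ p ] , (σ ▷ vp , Unique.++⁺ qs! Unique-[x] λ { (p∈qs , here refl) → p∉Tq (in-Tq p∈qs) }) ,
    All-++⁺ (All.tabulate (inj₁ ∘ in-Tq)) (inj₂ refl ∷ [])
    where
    in-Tq : ∀ {z} → z ∈ qs → Sub par q z
    in-Tq = All.lookup vs⊆Tq ∘ qs⊆vs

  path-from-q-through-p : HasSize (δ S par q) 1 → ∀ {d} → δ S par p d →
                          ∃[ fs ] (SimplePath adj q d fs × p ∈ fs × All (λ z → Sub par p z ⊎ z ≡ d) fs)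
  path-from-q-through-p |δq|≡1 {d} ∂d = through path-from-q-to-p (route-to-p |δq|≡1 ∂d)
    where
    through : ∃[ ps ] (SimplePath adj q p ps × All (λ z → Sub par q z ⊎ z ≡ p) ps) →
              ∃[ rs ] (SimplePath adj d p (d ∷ rs) × All (λ z → Sub par p z × ¬ Sub par q z) rs) →
              ∃[ fs ] (SimplePath adj q d fs × p ∈ fs × All (λ z → Sub par p z ⊎ z ≡ d) fs)
    through (ps , Q , ps-ok) (rs , R , rs-ok) =
      let (ks , R⁻ , ks⊆ , _)          = reverse-simple adj-sym R
          (fs , F , ps⊆fs , _ , fs⊆) = join-simple Q R⁻ λ z∈ps z∈ks → meet (All.lookup ps-ok z∈ps) (ks⊆ z∈ks)
      in fs , F , ps⊆fs (last∈ (proj₁ Q)) , All.tabulate ([ in-Q , in-R ∘ ks⊆ ]′ ∘ ∈-++⁻ ps ∘ fs⊆)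
      where
      meet : ∀ {z} → Sub par q z ⊎ z ≡ p → z ∈ d ∷ rs → z ≡ p
      meet (inj₂ z≡p)  _            = z≡p
      meet (inj₁ d∈Tq) (here refl)  = ⊥-elim (proj₁ ∂d (Anc-trans d∈Tq q↑p))
      meet (inj₁ z∈Tq) (there z∈rs) = ⊥-elim (proj₂ (All.lookup rs-ok z∈rs) z∈Tq)
      in-Q : ∀ {z} → z ∈ ps → Sub par p z ⊎ z ≡ d
      in-Q z∈ps = inj₁ ([ (λ z∈Tq → Anc-trans z∈Tq q↑p) , (λ { refl → self }) ]′ (All.lookup ps-ok z∈ps))
      in-R : ∀ {z} → z ∈ d ∷ rs → Sub par p z ⊎ z ≡ d
      in-R (here z≡d)   = inj₂ z≡d
      in-R (there z∈rs) = inj₁ (proj₁ (All.lookup rs-ok z∈rs))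

  necessity : SteinerClosed S par' → HasSize (δ S par p) 2 → HasSize (δ S par q) 1 → ⊥
  necessity sc' |δp|≡2 |δq|≡1 = pair-⊥ (HasSize-2⇒pair |δp|≡2)
    where
    ff : ForkFree (Anc∖p q)
    ff = forkFree-resp Anc'-q⇔Anc∖p (steinerClosed⇒forkFree (sc' q))
    in-Pq : ∀ {d} → δ S par p d → Anc∖p q d
    in-Pq ∂d@(d∉Tp , _) = Anc-trans q↑p (boundary⇒ancestor ∂d) , λ { refl → d∉Tp self }
    pair-⊥ : ∃[ d₁ ] ∃[ d₂ ] (δ S par p d₁ × δ S par p d₂ × d₁ ≢ d₂) → ⊥
    pair-⊥ (d₁ , d₂ , ∂₁ , ∂₂ , d₁≢d₂) =
      tripod (path-from-q-through-p |δq|≡1 ∂₁) (route-to-p |δq|≡1 ∂₂)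
      where
      tripod : ∃[ fs ] (SimplePath adj q d₁ fs × p ∈ fs × All (λ z → Sub par p z ⊎ z ≡ d₁) fs) →
               ∃[ rs ] (SimplePath adj d₂ p (d₂ ∷ rs) × All (λ z → Sub par p z × ¬ Sub par q z) rs) → ⊥
      tripod (fs , F , p∈fs , fs-ok) (rs , (R , _) , rs-ok) =
        no-tripod ff (self , q≢p) (in-Pq ∂₁) (in-Pq ∂₂) F R p∈fs shared∉A
        where
        shared∉A : ∀ {z} → z ∈ d₂ ∷ rs → z ∈ fs → ¬ Anc∖p q z
        shared∉A (here refl) d₂∈fs _ = [ proj₁ ∂₂ , d₁≢d₂ ∘ sym ]′ (All.lookup fs-ok d₂∈fs)
        shared∉A (there z∈rs) _ (q↑z , z≢p) =
          z≢p (Tp∖Tq∩Pq⊆p (proj₁ (All.lookup rs-ok z∈rs)) (proj₂ (All.lookup rs-ok z∈rs)) q↑z)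

lemma14 : ∀ {n} (S : UTree n) (par : Parent n) → IsSTT S par → SteinerClosed S par →
    (q p : Fin n) → par q ≡ just p → (par' : Parent n) → IsRotation S par q p par' →
    SteinerClosed S par' ⇔ (¬ HasSize (δ S par p) 2 ⊎ ¬ HasSize (δ S par q) 1)
lemma14 S par stt sc q p pq par' rot = mk⇔ condition-necessary (sufficiency sc)
  where
  open SearchTree S par stt using (δ-dec; parent∈boundary)
  open Rotation S par stt q p pq par' rot
  condition-necessary : SteinerClosed S par' → RotationCondition
  condition-necessary sc' with HasSize-1⊎another (δ-dec q) (parent∈boundary pq)
  ... | inj₁ |δq|≡1          = inj₁ λ |δp|≡2 → necessity sc' |δp|≡2 |δq|≡1
  ... | inj₂ (f , ∂f , f≢p) = inj₂ λ |δq|≡1 → f≢p (HasSize-1⇒≡ |δq|≡1 (parent∈boundary pq) ∂f)
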